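{- Let $n\ge 2$, $\sigma\in B_{n-1}$, and $\hat\sigma:=[n,\sigma(1),\ldots,\sigma(n-1)]\in B_n$. Then $\mathrm{oneg}(\hat\sigma)=\mathrm{eneg}(\sigma)$, $\mathrm{eneg}(\hat\sigma)=\mathrm{oneg}(\sigma)$, $\mathrm{oinv}(\hat\sigma)=\mathrm{oinv}(\sigma)+\lceil\frac{n-1}{2}\rceil$, $\mathrm{einv}(\hat\sigma)=\mathrm{einv}(\sigma)+\lfloor\frac{n-1}{2}\rfloor$, $\mathrm{onsp}(\hat\sigma)=\mathrm{onsp}(\sigma)$, $\mathrm{ensp}(\hat\sigma)=\mathrm{ensp}(\sigma)$.
   Context: $B_m$ is the group of signed permutations of $[m]$ (bijections $\sigma$ of $\{\pm1,\dots,\pm m\}$ with $\sigma(-i)=-\sigma(i)$), written in window notation $[\sigma(1),\dots,\sigma(m)]$. For $\sigma\in B_m$: $\mathrm{oneg}(\sigma)$ (resp. $\mathrm{eneg}(\sigma)$) is the number of $i\in[m]$ with $\sigma(i)<0$ and $i$ odd (resp. even); $\mathrm{oinv}(\sigma)$ (resp. $\mathrm{einv}(\sigma)$) is the number of pairs $1\le i<j\le m$ with $\sigma(i)>\sigma(j)$ and $j-i$ odd (resp. even); $\mathrm{onsp}(\sigma)$ (resp. $\mathrm{ensp}(\sigma)$) is the number of pairs $1\le i<j\le m$ with $\sigma(i)+\sigma(j)<0$ and $j-i$ odd (resp. even). -}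

module Defs where

open import Data.Nat as ℕ using (ℕ; zero; suc; _∸_; _≤_; _<_)
open import Data.Nat.Base using (_%_)
open import Data.Nat.Properties using () renaming (_≟_ to _≟ℕ_)
open import Data.Integer as ℤ using (ℤ; +_; ∣_∣)
import Data.Integer.Properties as ℤP
open import Data.Fin as Fin using (Fin; toℕ)
open import Data.Vec as Vec using (Vec; lookup; _∷_)
open import Data.List as List using (List; length; filter; allFin; cartesianProduct)
open import Data.Product using (_×_; _,_; proj₁; proj₂)
open import Relation.Binary.PropositionalEquality using (_≡_)
open import Relation.Nullary using (¬_; Dec; _×-dec_)
open import Relation.Unary using (Pred; Decidable)

even? : (k : ℕ) → Dec (k % 2 ≡ 0)
even? k = (k % 2) ≟ℕ 0

odd? : (k : ℕ) → Dec (k % 2 ≡ 1)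
odd? k = (k % 2) ≟ℕ 1

-- A signed permutation of [m] in window notation: w = [σ(1),…,σ(m)],
-- stored as a vector of integers indexed by Fin m (index i ↦ position toℕ i + 1).
-- σ is determined by its window (σ(-i) = -σ(i)); the window is a signed
-- permutation iff each entry has absolute value in {1,…,m} and the
-- absolute values are pairwise distinct.
record IsSignedPerm {m : ℕ} (w : Vec ℤ m) : Set where
  field
    absRange    : ∀ i → 1 ≤ ∣ lookup w i ∣ × ∣ lookup w i ∣ ≤ m
    absInjective : ∀ i j → ∣ lookup w i ∣ ≡ ∣ lookup w j ∣ → i ≡ j

count : ∀ {a p} {A : Set a} {P : Pred A p} → Decidable P → List A → ℕ
count P? xs = length (filter P? xs)

-- positions i ∈ [m], written as Fin m; position number is toℕ i + 1
positions : (m : ℕ) → List (Fin m)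
positions m = allFin m

Pair : ℕ → Set
Pair m = Fin m × Fin m

pairs : (m : ℕ) → List (Pair m)
pairs m = filter (λ p → toℕ (proj₁ p) ℕ.<? toℕ (proj₂ p)) (cartesianProduct (allFin m) (allFin m))

-- position toℕ i + 1 is odd  iff  toℕ i is even
oneg : ∀ {m} → Vec ℤ m → ℕ
oneg {m} w = count (λ i → (lookup w i ℤ.<? + 0) ×-dec even? (toℕ i)) (positions m)

eneg : ∀ {m} → Vec ℤ m → ℕ
eneg {m} w = count (λ i → (lookup w i ℤ.<? + 0) ×-dec odd? (toℕ i)) (positions m)

gap : ∀ {m} → Pair m → ℕ
gap (i , j) = toℕ j ∸ toℕ i

oinv : ∀ {m} → Vec ℤ m → ℕ
oinv {m} w = count (λ p → (lookup w (proj₂ p) ℤ.<? lookup w (proj₁ p)) ×-dec odd? (gap p)) (pairs m)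

einv : ∀ {m} → Vec ℤ m → ℕ
einv {m} w = count (λ p → (lookup w (proj₂ p) ℤ.<? lookup w (proj₁ p)) ×-dec even? (gap p)) (pairs m)

onsp : ∀ {m} → Vec ℤ m → ℕ
onsp {m} w = count (λ p → ((lookup w (proj₁ p) ℤ.+ lookup w (proj₂ p)) ℤ.<? + 0) ×-dec odd? (gap p)) (pairs m)

ensp : ∀ {m} → Vec ℤ m → ℕ
ensp {m} w = count (λ p → ((lookup w (proj₁ p) ℤ.+ lookup w (proj₂ p)) ℤ.<? + 0) ×-dec even? (gap p)) (pairs m)

module Submission where

-- Every statistic in Defs counts the positions, or the ordered pairs of
-- positions, satisfying a decidable property.
-- Shifting keeps every gap and swaps the parity of a position, so in each
-- statistic of a ∷ σ the shifted part is exactly the statistic of σ (with odd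
-- and even exchanged for oneg/eneg).  The rest is the contribution of the new
-- first entry a, assumed to exceed every |σ(i)| (module Prepend): it is not
-- negative, it is inverted with every later entry, and it is in no pair of
-- negative sum.  The later positions j+1 whose gap j is odd resp. even
-- number ⌈m/2⌉ resp. ⌊m/2⌋.

open import Defs
open import Data.Nat using (ℕ; suc; _+_; _≥_; ⌈_/2⌉; ⌊_/2⌋; _∸_)
open import Data.Integer using (ℤ; +_)
open import Data.Vec using (Vec; _∷_)
open import Data.Product using (_×_)
open import Relation.Binary.PropositionalEquality using (_≡_)

open import Level using (Level)
open import Function using (id; _∘_)
open import Data.Nat as ℕ using (zero; _%_; s≤s)
import Data.Nat.Properties as ℕP
open import Data.Integer as ℤ using (-[1+_]; ∣_∣)
import Data.Integer.Properties as ℤP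
open import Data.Fin as Fin using (Fin; toℕ)
open import Data.Vec using (lookup)
open import Data.List using (List; []; _∷_; _++_; map; filter; allFin; cartesianProduct; length)
import Data.List.Properties as ListP
import Data.List.Relation.Unary.All as All
open import Data.Product using (_,_; proj₁; proj₂)
open import Relation.Binary.PropositionalEquality using (refl; sym; trans; cong; cong₂; subst; module ≡-Reasoning)
open import Relation.Nullary using (¬_; Dec; yes; no; _×-dec_)
open import Relation.Unary using (Pred; Decidable; _≐_; _∩_)

open ≡-Reasoning

private variable
  ℓ₁ ℓ₂ p q : Level
  A : Set ℓ₁
  B : Set ℓ₂

count-accept : {P : Pred A p} (P? : Decidable P) {x : A} (xs : List A) →
               P x → count P? (x ∷ xs) ≡ suc (count P? xs)
count-accept P? xs px = cong length (ListP.filter-accept P? px)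

count-reject : {P : Pred A p} (P? : Decidable P) {x : A} (xs : List A) →
               ¬ P x → count P? (x ∷ xs) ≡ count P? xs
count-reject P? xs ¬px = cong length (ListP.filter-reject P? ¬px)

count-≐ : {P : Pred A p} {Q : Pred A q} (P? : Decidable P) (Q? : Decidable Q) →
          P ≐ Q → (xs : List A) → count P? xs ≡ count Q? xs
count-≐ P? Q? P≐Q xs = cong length (ListP.filter-≐ P? Q? P≐Q xs)

count-none : {P : Pred A p} (P? : Decidable P) → (∀ x → ¬ P x) →
             (xs : List A) → count P? xs ≡ 0
count-none P? none xs = cong length (ListP.filter-none P? (All.universal none xs))

count-++ : {P : Pred A p} (P? : Decidable P) (xs ys : List A) →
           count P? (xs ++ ys) ≡ count P? xs + count P? ys
count-++ P? xs ys = trans (cong length (ListP.filter-++ P? xs ys)) (ListP.length-++ (filter P? xs))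

count-map : {P : Pred B p} (P? : Decidable P) (f : A → B) (xs : List A) →
            count P? (map f xs) ≡ count (P? ∘ f) xs
count-map P? f [] = refl
count-map P? f (x ∷ xs) with P? (f x)
... | yes _ = cong suc (count-map P? f xs)
... | no _  = count-map P? f xs

∩-congʳ : {P : Pred A p} {Q Q′ : Pred A q} → Q ≐ Q′ → (P ∩ Q) ≐ (P ∩ Q′)
∩-congʳ (Q⊆Q′ , Q′⊆Q) = (λ {x} (p , q) → p , Q⊆Q′ {x} q) , (λ {x} (p , q) → p , Q′⊆Q {x} q)

count-filter : {P : Pred A p} {Q : Pred A q} (P? : Decidable P) (Q? : Decidable Q)
               (xs : List A) → count Q? (filter P? xs) ≡ count (λ x → P? x ×-dec Q? x) xs
count-filter P? Q? [] = refl
count-filter {P = P} {Q} P? Q? (x ∷ xs) = by-cases (P? x) (Q? x)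
  where
  PQ? = λ x → P? x ×-dec Q? x
  by-cases : Dec (P x) → Dec (Q x) → count Q? (filter P? (x ∷ xs)) ≡ count PQ? (x ∷ xs)
  by-cases (no ¬p) _ = begin
    count Q? (filter P? (x ∷ xs))  ≡⟨ cong (count Q?) (ListP.filter-reject P? ¬p) ⟩
    count Q? (filter P? xs)        ≡⟨ count-filter P? Q? xs ⟩
    count PQ? xs                   ≡⟨ count-reject PQ? xs (¬p ∘ proj₁) ⟨
    count PQ? (x ∷ xs)             ∎
  by-cases (yes p) (yes q) = begin
    count Q? (filter P? (x ∷ xs))  ≡⟨ cong (count Q?) (ListP.filter-accept P? p) ⟩
    count Q? (x ∷ filter P? xs)    ≡⟨ count-accept Q? (filter P? xs) q ⟩
    suc (count Q? (filter P? xs))  ≡⟨ cong suc (count-filter P? Q? xs) ⟩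
    suc (count PQ? xs)             ≡⟨ count-accept PQ? xs (p , q) ⟨
    count PQ? (x ∷ xs)             ∎
  by-cases (yes p) (no ¬q) = begin
    count Q? (filter P? (x ∷ xs))  ≡⟨ cong (count Q?) (ListP.filter-accept P? p) ⟩
    count Q? (x ∷ filter P? xs)    ≡⟨ count-reject Q? (filter P? xs) ¬q ⟩
    count Q? (filter P? xs)        ≡⟨ count-filter P? Q? xs ⟩
    count PQ? xs                   ≡⟨ count-reject PQ? xs (¬q ∘ proj₂) ⟨
    count PQ? (x ∷ xs)             ∎

count-cartesian-∷ : {R : Pred (A × B) p} (R? : Decidable R) (x : A) (xs : List A) (ys : List B) →
                    count R? (cartesianProduct (x ∷ xs) ys)
                      ≡ count (R? ∘ (x ,_)) ys + count R? (cartesianProduct xs ys)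
count-cartesian-∷ R? x xs ys =
  trans (count-++ R? (map (x ,_) ys) (cartesianProduct xs ys))
        (cong (_+ count R? (cartesianProduct xs ys)) (count-map R? (x ,_) ys))

allFin-suc : (m : ℕ) → allFin (suc m) ≡ Fin.zero ∷ map Fin.suc (allFin m)
allFin-suc m = cong (Fin.zero ∷_) (sym (ListP.map-tabulate id Fin.suc))

count-positions-reject : {m : ℕ} {P : Pred (Fin (suc m)) p} (P? : Decidable P) →
                         ¬ P Fin.zero → count P? (positions (suc m)) ≡ count (P? ∘ Fin.suc) (positions m)
count-positions-reject {m = m} P? ¬p0 = begin
  count P? (allFin (suc m))                      ≡⟨ cong (count P?) (allFin-suc m) ⟩
  count P? (Fin.zero ∷ map Fin.suc (allFin m))   ≡⟨ count-reject P? _ ¬p0 ⟩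
  count P? (map Fin.suc (allFin m))              ≡⟨ count-map P? Fin.suc (allFin m) ⟩
  count (P? ∘ Fin.suc) (allFin m)                ∎

count-positions-accept : {m : ℕ} {P : Pred (Fin (suc m)) p} (P? : Decidable P) →
                         P Fin.zero → count P? (positions (suc m)) ≡ suc (count (P? ∘ Fin.suc) (positions m))
count-positions-accept {m = m} P? p0 = begin
  count P? (allFin (suc m))                      ≡⟨ cong (count P?) (allFin-suc m) ⟩
  count P? (Fin.zero ∷ map Fin.suc (allFin m))   ≡⟨ count-accept P? _ p0 ⟩
  suc (count P? (map Fin.suc (allFin m)))        ≡⟨ cong suc (count-map P? Fin.suc (allFin m)) ⟩
  suc (count (P? ∘ Fin.suc) (allFin m))          ∎

shift : {m : ℕ} → Pair m → Pair (suc m)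
shift (i , j) = Fin.suc i , Fin.suc j

Ordered : {m : ℕ} → Pred (Pair m) _
Ordered (i , j) = toℕ i ℕ.< toℕ j

ordered? : {m : ℕ} → Decidable (Ordered {m})
ordered? (i , j) = toℕ i ℕ.<? toℕ j

ordered-shift : {m : ℕ} → (Ordered ∘ shift {m}) ≐ Ordered
ordered-shift = ℕ.s≤s⁻¹ , s≤s

-- Among pairs (i + 1 , y) of [m + 1], only y = j + 1 can be ordered, and the
-- count reduces to the shifted pairs (i , j) of [m].
count-ordered-shifted-rows :
  {m : ℕ} {R : Pred (Pair (suc m)) p} (R? : Decidable R) (xs ys : List (Fin m)) →
  count (λ p → ordered? p ×-dec R? p) (cartesianProduct (map Fin.suc xs) (Fin.zero ∷ map Fin.suc ys))
    ≡ count (λ p → ordered? p ×-dec R? (shift p)) (cartesianProduct xs ys)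
count-ordered-shifted-rows R? [] ys = refl
count-ordered-shifted-rows {R = R} R? (x ∷ xs) ys = begin
  count OR? (cartesianProduct (Fin.suc x ∷ map Fin.suc xs) (Fin.zero ∷ map Fin.suc ys))
    ≡⟨ count-cartesian-∷ OR? (Fin.suc x) (map Fin.suc xs) (Fin.zero ∷ map Fin.suc ys) ⟩
  count (λ y → OR? (Fin.suc x , y)) (Fin.zero ∷ map Fin.suc ys)
    + count OR? (cartesianProduct (map Fin.suc xs) (Fin.zero ∷ map Fin.suc ys))
    ≡⟨ cong₂ _+_ row (count-ordered-shifted-rows R? xs ys) ⟩
  count (λ y → OR'? (x , y)) ys + count OR'? (cartesianProduct xs ys)
    ≡⟨ count-cartesian-∷ OR'? x xs ys ⟨
  count OR'? (cartesianProduct (x ∷ xs) ys) ∎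
  where
  OR? = λ p → ordered? p ×-dec R? p
  OR'? = λ p → ordered? p ×-dec R? (shift p)
  row : count (λ y → OR? (Fin.suc x , y)) (Fin.zero ∷ map Fin.suc ys) ≡ count (λ y → OR'? (x , y)) ys
  row = begin
    count (λ y → OR? (Fin.suc x , y)) (Fin.zero ∷ map Fin.suc ys)
      ≡⟨ count-reject (λ y → OR? (Fin.suc x , y)) (map Fin.suc ys) (ℕP.n≮0 ∘ proj₁) ⟩
    count (λ y → OR? (Fin.suc x , y)) (map Fin.suc ys)
      ≡⟨ count-map (λ y → OR? (Fin.suc x , y)) Fin.suc ys ⟩
    count (λ j → OR? (shift (x , j))) ys
      ≡⟨ count-≐ (λ j → OR? (shift (x , j))) (λ y → OR'? (x , y))
                 ((λ (o , r) → proj₁ ordered-shift o , r) , (λ (o , r) → proj₂ ordered-shift o , r)) ys ⟩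
    count (λ y → OR'? (x , y)) ys ∎

count-pairs-suc : (m : ℕ) {R : Pred (Pair (suc m)) p} (R? : Decidable R) →
  count R? (pairs (suc m))
    ≡ count (λ j → R? (Fin.zero , Fin.suc j)) (positions m) + count (R? ∘ shift) (pairs m)
count-pairs-suc m R? = begin
  count R? (pairs (suc m))
    ≡⟨ count-filter ordered? R? (cartesianProduct (allFin (suc m)) (allFin (suc m))) ⟩
  count OR? (cartesianProduct (allFin (suc m)) (allFin (suc m)))
    ≡⟨ cong (λ xs → count OR? (cartesianProduct xs xs)) (allFin-suc m) ⟩
  count OR? (cartesianProduct (Fin.zero ∷ map Fin.suc (allFin m)) (Fin.zero ∷ map Fin.suc (allFin m)))
    ≡⟨ count-cartesian-∷ OR? Fin.zero (map Fin.suc (allFin m)) (Fin.zero ∷ map Fin.suc (allFin m)) ⟩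
  count (λ y → OR? (Fin.zero , y)) (Fin.zero ∷ map Fin.suc (allFin m))
    + count OR? (cartesianProduct (map Fin.suc (allFin m)) (Fin.zero ∷ map Fin.suc (allFin m)))
    ≡⟨ cong₂ _+_ first-row (count-ordered-shifted-rows R? (allFin m) (allFin m)) ⟩
  count (λ j → R? (Fin.zero , Fin.suc j)) (allFin m)
    + count (λ p → ordered? p ×-dec R? (shift p)) (cartesianProduct (allFin m) (allFin m))
    ≡⟨ cong (_+_ (count (λ j → R? (Fin.zero , Fin.suc j)) (allFin m)))
            (count-filter ordered? (R? ∘ shift) (cartesianProduct (allFin m) (allFin m))) ⟨
  count (λ j → R? (Fin.zero , Fin.suc j)) (allFin m) + count (R? ∘ shift) (pairs m) ∎
  where
  OR? = λ p → ordered? p ×-dec R? p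
  first-row : count (λ y → OR? (Fin.zero , y)) (Fin.zero ∷ map Fin.suc (allFin m))
              ≡ count (λ j → R? (Fin.zero , Fin.suc j)) (allFin m)
  first-row = begin
    count (λ y → OR? (Fin.zero , y)) (Fin.zero ∷ map Fin.suc (allFin m))
      ≡⟨ count-reject (λ y → OR? (Fin.zero , y)) (map Fin.suc (allFin m)) (ℕP.n≮0 ∘ proj₁) ⟩
    count (λ y → OR? (Fin.zero , y)) (map Fin.suc (allFin m))
      ≡⟨ count-map (λ y → OR? (Fin.zero , y)) Fin.suc (allFin m) ⟩
    count (λ j → OR? (Fin.zero , Fin.suc j)) (allFin m)
      ≡⟨ count-≐ (λ j → OR? (Fin.zero , Fin.suc j)) (λ j → R? (Fin.zero , Fin.suc j))
                 (proj₂ , (λ r → s≤s ℕ.z≤n , r)) (allFin m) ⟩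
    count (λ j → R? (Fin.zero , Fin.suc j)) (allFin m) ∎

Even Odd : Pred ℕ _
Even k = k % 2 ≡ 0
Odd k = k % 2 ≡ 1

odd⇒even-suc : ∀ k → Odd k → Even (suc k)
odd⇒even-suc (suc zero) _ = refl
odd⇒even-suc (suc (suc k)) odd = odd⇒even-suc k odd

even-suc⇒odd : ∀ k → Even (suc k) → Odd k
even-suc⇒odd (suc zero) _ = refl
even-suc⇒odd (suc (suc k)) even = even-suc⇒odd k even

even⇒odd-suc : ∀ k → Even k → Odd (suc k)
even⇒odd-suc zero _ = refl
even⇒odd-suc (suc (suc k)) even = even⇒odd-suc k even

odd-suc⇒even : ∀ k → Odd (suc k) → Even k
odd-suc⇒even zero _ = refl
odd-suc⇒even (suc (suc k)) odd = odd-suc⇒even k odd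

even-suc≐odd : {m : ℕ} → (Even ∘ toℕ ∘ Fin.suc {m}) ≐ (Odd ∘ toℕ)
even-suc≐odd = (λ {i} → even-suc⇒odd (toℕ i)) , (λ {i} → odd⇒even-suc (toℕ i))

odd-suc≐even : {m : ℕ} → (Odd ∘ toℕ ∘ Fin.suc {m}) ≐ (Even ∘ toℕ)
odd-suc≐even = (λ {i} → odd-suc⇒even (toℕ i)) , (λ {i} → even⇒odd-suc (toℕ i))

-- Of the positions 1, …, m, the odd ones (0-based index even) number ⌈m/2⌉
-- and the even ones ⌊m/2⌋.
count-even-indices : (m : ℕ) → count (even? ∘ toℕ) (positions m) ≡ ⌈ m /2⌉
count-odd-indices : (m : ℕ) → count (odd? ∘ toℕ) (positions m) ≡ ⌊ m /2⌋

count-even-indices zero = refl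
count-even-indices (suc m) = begin
  count (even? ∘ toℕ) (positions (suc m))
    ≡⟨ count-positions-accept {m = m} (even? ∘ toℕ) refl ⟩
  suc (count (even? ∘ toℕ ∘ Fin.suc) (positions m))
    ≡⟨ cong suc (count-≐ (even? ∘ toℕ ∘ Fin.suc) (odd? ∘ toℕ) even-suc≐odd (positions m)) ⟩
  suc (count (odd? ∘ toℕ) (positions m))
    ≡⟨ cong suc (count-odd-indices m) ⟩
  suc ⌊ m /2⌋ ∎

count-odd-indices zero = refl
count-odd-indices (suc m) = begin
  count (odd? ∘ toℕ) (positions (suc m))
    ≡⟨ count-positions-reject {m = m} (odd? ∘ toℕ) (λ ()) ⟩
  count (odd? ∘ toℕ ∘ Fin.suc) (positions m)
    ≡⟨ count-≐ (odd? ∘ toℕ ∘ Fin.suc) (even? ∘ toℕ) odd-suc≐even (positions m) ⟩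
  count (even? ∘ toℕ) (positions m)
    ≡⟨ count-even-indices m ⟩
  ⌈ m /2⌉ ∎

dominated-below : {a : ℕ} (x : ℤ) → ∣ x ∣ ℕ.< a → x ℤ.< + a
dominated-below (+ b) b<a = ℤ.+<+ b<a
dominated-below -[1+ b ] _ = ℤ.-<+

dominated-sum-nonnegative : {a : ℕ} (x : ℤ) → ∣ x ∣ ℕ.< a → ¬ (+ a ℤ.+ x ℤ.< + 0)
dominated-sum-nonnegative (+ b) _ = ℤP.+≮0
dominated-sum-nonnegative -[1+ b ] b<a = ℤP.+≮0 ∘ subst (ℤ._< + 0) (ℤP.⊖-≥ (ℕP.<⇒≤ b<a))

module Prepend {m : ℕ} (a : ℕ) (σ : Vec ℤ m) (dominated : ∀ i → ∣ lookup σ i ∣ ℕ.< a) where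

  -- The first entry is not negative, and the other positions swap parity.
  oneg-prepend : oneg (+ a ∷ σ) ≡ eneg σ
  oneg-prepend = begin
    oneg (+ a ∷ σ)
      ≡⟨ count-positions-reject (λ i → (lookup (+ a ∷ σ) i ℤ.<? + 0) ×-dec even? (toℕ i))
                                (ℤP.+≮0 ∘ proj₁) ⟩
    count (λ i → (lookup σ i ℤ.<? + 0) ×-dec even? (suc (toℕ i))) (positions m)
      ≡⟨ count-≐ (λ i → (lookup σ i ℤ.<? + 0) ×-dec even? (suc (toℕ i)))
                 (λ i → (lookup σ i ℤ.<? + 0) ×-dec odd? (toℕ i)) (∩-congʳ even-suc≐odd) (positions m) ⟩
    eneg σ ∎

  eneg-prepend : eneg (+ a ∷ σ) ≡ oneg σ
  eneg-prepend = begin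
    eneg (+ a ∷ σ)
      ≡⟨ count-positions-reject (λ i → (lookup (+ a ∷ σ) i ℤ.<? + 0) ×-dec odd? (toℕ i))
                                (ℤP.+≮0 ∘ proj₁) ⟩
    count (λ i → (lookup σ i ℤ.<? + 0) ×-dec odd? (suc (toℕ i))) (positions m)
      ≡⟨ count-≐ (λ i → (lookup σ i ℤ.<? + 0) ×-dec odd? (suc (toℕ i)))
                 (λ i → (lookup σ i ℤ.<? + 0) ×-dec even? (toℕ i)) (∩-congʳ odd-suc≐even) (positions m) ⟩
    oneg σ ∎

  -- The first entry is inverted with the entry at every later index j + 1,
  -- at gap j + 1; this gap is odd exactly when j is even.
  oinv-prepend : oinv (+ a ∷ σ) ≡ oinv σ + ⌈ m /2⌉
  oinv-prepend = begin
    oinv (+ a ∷ σ)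
      ≡⟨ count-pairs-suc m _ ⟩
    count (λ j → (lookup σ j ℤ.<? + a) ×-dec odd? (suc (toℕ j))) (positions m) + oinv σ
      ≡⟨ cong (_+ oinv σ) (count-≐ (λ j → (lookup σ j ℤ.<? + a) ×-dec odd? (suc (toℕ j)))
                                   (even? ∘ toℕ) odd-gap≐even (positions m)) ⟩
    count (even? ∘ toℕ) (positions m) + oinv σ
      ≡⟨ cong (_+ oinv σ) (count-even-indices m) ⟩
    ⌈ m /2⌉ + oinv σ
      ≡⟨ ℕP.+-comm ⌈ m /2⌉ (oinv σ) ⟩
    oinv σ + ⌈ m /2⌉ ∎
    where
    odd-gap≐even : (λ j → lookup σ j ℤ.< + a × Odd (suc (toℕ j))) ≐ (Even ∘ toℕ)
    odd-gap≐even = (λ {j} (_ , odd) → proj₁ odd-suc≐even {j} odd)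
                 , (λ {j} even → dominated-below (lookup σ j) (dominated j) , proj₂ odd-suc≐even {j} even)

  einv-prepend : einv (+ a ∷ σ) ≡ einv σ + ⌊ m /2⌋
  einv-prepend = begin
    einv (+ a ∷ σ)
      ≡⟨ count-pairs-suc m _ ⟩
    count (λ j → (lookup σ j ℤ.<? + a) ×-dec even? (suc (toℕ j))) (positions m) + einv σ
      ≡⟨ cong (_+ einv σ) (count-≐ (λ j → (lookup σ j ℤ.<? + a) ×-dec even? (suc (toℕ j)))
                                   (odd? ∘ toℕ) even-gap≐odd (positions m)) ⟩
    count (odd? ∘ toℕ) (positions m) + einv σ
      ≡⟨ cong (_+ einv σ) (count-odd-indices m) ⟩
    ⌊ m /2⌋ + einv σ
      ≡⟨ ℕP.+-comm ⌊ m /2⌋ (einv σ) ⟩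
    einv σ + ⌊ m /2⌋ ∎
    where
    even-gap≐odd : (λ j → lookup σ j ℤ.< + a × Even (suc (toℕ j))) ≐ (Odd ∘ toℕ)
    even-gap≐odd = (λ {j} (_ , even) → proj₁ even-suc≐odd {j} even)
                 , (λ {j} odd → dominated-below (lookup σ j) (dominated j) , proj₂ even-suc≐odd {j} odd)

  -- The first entry is in no pair of negative sum.
  onsp-prepend : onsp (+ a ∷ σ) ≡ onsp σ
  onsp-prepend = begin
    onsp (+ a ∷ σ)
      ≡⟨ count-pairs-suc m _ ⟩
    count (λ j → ((+ a ℤ.+ lookup σ j) ℤ.<? + 0) ×-dec odd? (suc (toℕ j))) (positions m) + onsp σ
      ≡⟨ cong (_+ onsp σ) (count-none _ first-pair-nonnegative (positions m)) ⟩
    onsp σ ∎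
    where
    first-pair-nonnegative : ∀ j → ¬ ((+ a ℤ.+ lookup σ j) ℤ.< + 0 × Odd (suc (toℕ j)))
    first-pair-nonnegative j = dominated-sum-nonnegative (lookup σ j) (dominated j) ∘ proj₁

  ensp-prepend : ensp (+ a ∷ σ) ≡ ensp σ
  ensp-prepend = begin
    ensp (+ a ∷ σ)
      ≡⟨ count-pairs-suc m _ ⟩
    count (λ j → ((+ a ℤ.+ lookup σ j) ℤ.<? + 0) ×-dec even? (suc (toℕ j))) (positions m) + ensp σ
      ≡⟨ cong (_+ ensp σ) (count-none _ first-pair-nonnegative (positions m)) ⟩
    ensp σ ∎
    where
    first-pair-nonnegative : ∀ j → ¬ ((+ a ℤ.+ lookup σ j) ℤ.< + 0 × Even (suc (toℕ j)))
    first-pair-nonnegative j = dominated-sum-nonnegative (lookup σ j) (dominated j) ∘ proj₁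

-- In σ ∈ B_{n-1} every |σ(i)| ≤ n - 1 < n, so n dominates σ.
mainTheorem5 : (n : ℕ) → n ≥ 2 →
    (σ : Vec ℤ (n ∸ 1)) → IsSignedPerm σ →
      oneg (+ n ∷ σ) ≡ eneg σ
      × eneg (+ n ∷ σ) ≡ oneg σ
      × oinv (+ n ∷ σ) ≡ oinv σ + ⌈ n ∸ 1 /2⌉
      × einv (+ n ∷ σ) ≡ einv σ + ⌊ n ∸ 1 /2⌋
      × onsp (+ n ∷ σ) ≡ onsp σ
      × ensp (+ n ∷ σ) ≡ ensp σ
mainTheorem5 n@(suc _) _ σ signed =
  oneg-prepend , eneg-prepend , oinv-prepend , einv-prepend , onsp-prepend , ensp-prepend
  where
  open Prepend n σ (λ i → s≤s (proj₂ (IsSignedPerm.absRange signed i)))
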